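{- Let $m,k\ge1$ and let $h$ be a homomorphism from $\mathbf{Z}_{2m+1}$ into $\mathbf{Z}_k$. Then $k=2n+1$ for some $n\ge0$, and if $a,b\in\mathbf{Z}_{2m+1}$ are distinct and such that $h(a)=h(b)$, then $h(a)=0=h(b)$. Moreover, two endomorphisms $h_1,h_2$ of $\mathbf{Z}_{2m+1}$ are equal if and only if their images coincide, and there is a bijection between the endomorphisms of $\mathbf{Z}_{2m+1}$ and the subalgebras of $\mathbf{Z}_{2m+1}$ that contain $0$.
   Context: $\mathbf{Z}=(\mathbb{Z};\wedge,\vee,\to,\neg)$ is the Sugihara algebra of integers: lattice operations from the natural order, $\neg a=-a$, $a\to b=(-a)\vee b$ if $a\le b$ and $(-a)\wedge b$ otherwise. For $n\ge0$, $\mathbf{Z}_{2n+1}$ is the subalgebra on $\{a\mid -n\le a\le n\}$; for $n\ge1$, $\mathbf{Z}_{2n}$ is the subalgebra on $\{a\mid -n\le a\le n\}\setminus\{0\}$. -}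

module Defs where

open import Data.Nat as ℕ using (ℕ)
open import Data.Integer using (ℤ; +_; -_; _⊓_; _⊔_; _≤_; _≤ᵇ_; 0ℤ)
open import Data.Bool using (Bool; true; false; if_then_else_)
open import Data.Product using (Σ; _×_; _,_; ∃; proj₁)
open import Data.Sum using (_⊎_)
open import Relation.Nullary using (¬_)
open import Relation.Binary.PropositionalEquality using (_≡_; _≢_; refl; sym; trans)
open import Relation.Binary.Bundles using (Setoid)
open import Function.Bundles using (_⇔_)
open import Level using (0ℓ)

-- Sugihara algebra Z on the integers
infixr 7 _∧_
infixr 6 _∨_
infixr 5 _⇒_

_∧_ : ℤ → ℤ → ℤ
a ∧ b = a ⊓ b

_∨_ : ℤ → ℤ → ℤ
a ∨ b = a ⊔ b

neg : ℤ → ℤ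
neg a = - a

_⇒_ : ℤ → ℤ → ℤ
a ⇒ b = if a ≤ᵇ b then (- a) ⊔ b else (- a) ⊓ b

-- Membership in the subalgebra Z_k (k ≥ 1):
--   k = 2n+1 (n ≥ 0): { a | -n ≤ a ≤ n }
--   k = 2n   (n ≥ 1): { a | -n ≤ a ≤ n } \ {0}
-- (For k = 0 this predicate is empty; it is only used for k ≥ 1.)
InZ : ℕ → ℤ → Set
InZ k a =
  (Σ ℕ λ n → (k ≡ 2 ℕ.* n ℕ.+ 1) × (- (+ n) ≤ a) × (a ≤ + n))
  ⊎ (Σ ℕ λ n → (1 ℕ.≤ n) × (k ≡ 2 ℕ.* n) × (- (+ n) ≤ a) × (a ≤ + n) × (a ≢ 0ℤ))

IsHom : ℕ → ℕ → (ℤ → ℤ) → Set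
IsHom k l h =
  (∀ a → InZ k a → InZ l (h a))
  × (∀ a b → InZ k a → InZ k b → h (a ∧ b) ≡ h a ∧ h b)
  × (∀ a b → InZ k a → InZ k b → h (a ∨ b) ≡ h a ∨ h b)
  × (∀ a b → InZ k a → InZ k b → h (a ⇒ b) ≡ h a ⇒ h b)
  × (∀ a → InZ k a → h (neg a) ≡ neg (h a))

Hom : ℕ → ℕ → Set
Hom k l = Σ (ℤ → ℤ) (IsHom k l)

End : ℕ → Set
End k = Hom k k

HomEq : (k l : ℕ) → Hom k l → Hom k l → Set
HomEq k l (h₁ , _) (h₂ , _) = ∀ a → InZ k a → h₁ a ≡ h₂ a

Image : (k : ℕ) → (ℤ → ℤ) → ℤ → Set
Image k h c = Σ ℤ λ a → InZ k a × (h a ≡ c)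

SameImage : (k : ℕ) → (ℤ → ℤ) → (ℤ → ℤ) → Set
SameImage k h₁ h₂ = ∀ c → (Image k h₁ c → Image k h₂ c) × (Image k h₂ c → Image k h₁ c)

-- subsets of Z_k, represented by their (decidable) characteristic function
-- on ℤ; S is a subalgebra of Z_k if S ⊆ Z_k and S is closed under the operations
IsSubalg : ℕ → (ℤ → Bool) → Set
IsSubalg k S =
  (∀ a → S a ≡ true → InZ k a)
  × (∀ a b → S a ≡ true → S b ≡ true → S (a ∧ b) ≡ true)
  × (∀ a b → S a ≡ true → S b ≡ true → S (a ∨ b) ≡ true)
  × (∀ a b → S a ≡ true → S b ≡ true → S (a ⇒ b) ≡ true)
  × (∀ a → S a ≡ true → S (neg a) ≡ true)

Subalg0 : ℕ → Set
Subalg0 k = Σ (ℤ → Bool) λ S → IsSubalg k S × (S 0ℤ ≡ true)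

SubEq : (k : ℕ) → Subalg0 k → Subalg0 k → Set
SubEq k (S₁ , _) (S₂ , _) = ∀ a → S₁ a ≡ S₂ a

EndSetoid : ℕ → Setoid 0ℓ 0ℓ
EndSetoid k = record
  { Carrier = End k
  ; _≈_ = HomEq k k
  ; isEquivalence = record
    { refl = λ a _ → refl
    ; sym = λ p a i → sym (p a i)
    ; trans = λ p q a i → trans (p a i) (q a i)
    }
  }

Subalg0Setoid : ℕ → Setoid 0ℓ 0ℓ
Subalg0Setoid k = record
  { Carrier = Subalg0 k
  ; _≈_ = SubEq k
  ; isEquivalence = record
    { refl = λ a → refl
    ; sym = λ p a → sym (p a)
    ; trans = λ p q a → trans (p a) (q a)
    }
  }

module Submission where

-- A homomorphism h out of Z_{2m+1} fixes 0 (because 0 = ¬0), is monotone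
-- (because it preserves ∧), and can identify two distinct points only at 0:
-- for a < b with h a = h b = c, the elements a → b and b → a = ¬(a → b) are
-- both sent to c → c, so c → c = |c| is its own negation and c = 0.  Since 0
-- lies in the image, the codomain Z_k contains 0, i.e. k is odd.
--
-- Conversely, every odd monotone self-map of [-m, m] that collapses distinct
-- points only at 0 is an endomorphism.  Such a map is determined by its image
-- (a downward induction on [0, m]), and for every subalgebra S ∋ 0 there is
-- one with image S: enumerate S ∩ [0, m] from the top and send m, m-1, ... to
-- its elements in decreasing order, everything below to 0, and extend oddly.
-- Together these give the bijection between endomorphisms and subalgebras
-- containing 0, with the image map h ↦ h[Z_{2m+1}] as the forward direction.

open import Defs
open import Data.Nat using (ℕ; zero; suc; pred; _≤_; _<_; _+_; _*_; _∸_; z≤n; s≤s; s≤s⁻¹; _≤′_; ≤′-refl; ≤′-step)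
import Data.Nat.Properties as NP
open import Data.Integer as Z using (ℤ; 0ℤ; +_; -[1+_]; -_; _⊓_; _⊔_; _≤ᵇ_; +≤+; -≤+; -≤-; +<+)
import Data.Integer.Properties as ZP
open import Data.Bool using (Bool; true; false; if_then_else_)
open import Data.Bool.Properties using (⇔→≡)
open import Data.Product using (Σ; ∃; _×_; _,_; proj₁; proj₂)
open import Data.Sum using (_⊎_; inj₁; inj₂)
open import Data.Unit using (tt)
open import Data.Empty using (⊥; ⊥-elim)
open import Function using (_∘_; _⟨_⟩_)
open import Function.Bundles using (Inverse; _⇔_; mk⇔; Equivalence)
import Function.Properties.Equivalence as ⇔
open import Relation.Nullary using (Dec; yes; no; ¬_; does)
open import Relation.Nullary.Decidable using (map′; _⊎-dec_; does-⇔)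
open import Relation.Binary.PropositionalEquality
open import Relation.Binary.Definitions using (tri<; tri≈; tri>)

Within : ℕ → ℤ → Set
Within m a = (- (+ m) Z.≤ a) × (a Z.≤ + m)

InZ-odd⇒within : ∀ m {a} → InZ (2 * m + 1) a → Within m a
InZ-odd⇒within m (inj₁ (n , eq , bounds))
  with NP.*-cancelˡ-≡ m n 2 (NP.+-cancelʳ-≡ 1 (2 * m) (2 * n) eq)
... | refl = bounds
InZ-odd⇒within m (inj₂ (n , _ , eq , _)) =
  ⊥-elim (NP.even≢odd n m (trans (sym eq) (NP.+-comm (2 * m) 1)))

within⇒InZ-odd : ∀ m {a} → Within m a → InZ (2 * m + 1) a
within⇒InZ-odd m bounds = inj₁ (m , refl , bounds)

within-+ : ∀ {m n} → n ≤ m → Within m (+ n)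
within-+ n≤m = ZP.neg-≤-pos , +≤+ n≤m

within-+⁻¹ : ∀ {m n} → Within m (+ n) → n ≤ m
within-+⁻¹ (_ , +≤+ n≤m) = n≤m

within-0 : ∀ m → Within m 0ℤ
within-0 m = within-+ z≤n

within-neg : ∀ {m a} → Within m a → Within m (- a)
within-neg {m} {a} (l , u) =
  ZP.neg-mono-≤ u , subst (- a Z.≤_) (ZP.neg-involutive (+ m)) (ZP.neg-mono-≤ l)

within-⊓ : ∀ {m a b} → Within m a → Within m b → Within m (a ⊓ b)
within-⊓ {b = b} (l₁ , u₁) (l₂ , _) = ZP.⊓-glb l₁ l₂ , ZP.i≤j⇒i⊓k≤j b u₁

within-⊔ : ∀ {m a b} → Within m a → Within m b → Within m (a ⊔ b)
within-⊔ {b = b} (l₁ , u₁) (_ , u₂) = ZP.i≤j⇒i≤j⊔k b l₁ , ZP.⊔-lub u₁ u₂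

⇒-of-≤ : ∀ {a b} → a Z.≤ b → a ⇒ b ≡ - a ⊔ b
⇒-of-≤ {a} {b} a≤b with a ≤ᵇ b | ZP.≤⇒≤ᵇ a≤b
... | true | _ = refl

⇒-of-> : ∀ {a b} → b Z.< a → a ⇒ b ≡ - a ⊓ b
⇒-of-> {a} {b} b<a with a ≤ᵇ b | ZP.≤ᵇ⇒≤ {a} {b}
... | false | _ = refl
... | true | a≤b = ⊥-elim (ZP.<⇒≱ b<a (a≤b tt))

≤-or-> : ∀ a b → a Z.≤ b ⊎ b Z.< a
≤-or-> a b with a Z.≤? b
... | yes a≤b = inj₁ a≤b
... | no a≰b = inj₂ (ZP.≰⇒> a≰b)

within-⇒ : ∀ {m a b} → Within m a → Within m b → Within m (a ⇒ b)
within-⇒ {m} {a} {b} wa wb with ≤-or-> a b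
... | inj₁ a≤b = subst (Within m) (sym (⇒-of-≤ a≤b)) (within-⊔ (within-neg wa) wb)
... | inj₂ b<a = subst (Within m) (sym (⇒-of-> b<a)) (within-⊓ (within-neg wa) wb)

⇒-swap : ∀ {a b} → a Z.< b → b ⇒ a ≡ - (a ⇒ b)
⇒-swap {a} {b} a<b = begin
  b ⇒ a           ≡⟨ ⇒-of-> a<b ⟩
  - b ⊓ a         ≡⟨ ZP.⊓-comm (- b) a ⟩
  a ⊓ - b         ≡⟨ cong (_⊓ - b) (sym (ZP.neg-involutive a)) ⟩
  - - a ⊓ - b     ≡⟨ sym (ZP.neg-distrib-⊔-⊓ (- a) b) ⟩
  - (- a ⊔ b)     ≡⟨ cong -_ (sym (⇒-of-≤ (ZP.<⇒≤ a<b))) ⟩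
  - (a ⇒ b)       ∎
  where open ≡-Reasoning

self-neg⇒0 : ∀ {x} → x ≡ - x → x ≡ 0ℤ
self-neg⇒0 {+ zero} _ = refl
self-neg⇒0 {+ suc n} ()
self-neg⇒0 { -[1+ n ]} ()

-- c → c = |c|, which vanishes only at 0.
⇒-self≡0 : ∀ c → c ⇒ c ≡ 0ℤ → c ≡ 0ℤ
⇒-self≡0 c c⇒c≡0 = abs≡0 c (trans (sym (⇒-of-≤ ZP.≤-refl)) c⇒c≡0)
  where
  abs≡0 : ∀ c → - c ⊔ c ≡ 0ℤ → c ≡ 0ℤ
  abs≡0 (+ zero) _ = refl
  abs≡0 (+ suc n) ()
  abs≡0 -[1+ n ] ()

opposite-signs : ∀ x y → + x ≡ - (+ y) → x ≡ 0 × y ≡ 0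
opposite-signs zero zero _ = refl , refl
opposite-signs zero (suc y) ()
opposite-signs (suc x) zero ()
opposite-signs (suc x) (suc y) ()

module HomomorphismFacts (m k : ℕ) (h : ℤ → ℤ) (hom : IsHom (2 * m + 1) k h) where

  private
    inZ : ∀ {a} → Within m a → InZ (2 * m + 1) a
    inZ = within⇒InZ-odd m

  maps-into : ∀ {a} → Within m a → InZ k (h a)
  maps-into wa = proj₁ hom _ (inZ wa)

  preserves-⊓ : ∀ {a b} → Within m a → Within m b → h (a ⊓ b) ≡ h a ⊓ h b
  preserves-⊓ wa wb = proj₁ (proj₂ hom) _ _ (inZ wa) (inZ wb)

  preserves-⊔ : ∀ {a b} → Within m a → Within m b → h (a ⊔ b) ≡ h a ⊔ h b
  preserves-⊔ wa wb = proj₁ (proj₂ (proj₂ hom)) _ _ (inZ wa) (inZ wb)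

  preserves-⇒ : ∀ {a b} → Within m a → Within m b → h (a ⇒ b) ≡ h a ⇒ h b
  preserves-⇒ wa wb = proj₁ (proj₂ (proj₂ (proj₂ hom))) _ _ (inZ wa) (inZ wb)

  preserves-neg : ∀ {a} → Within m a → h (- a) ≡ - h a
  preserves-neg wa = proj₂ (proj₂ (proj₂ (proj₂ hom))) _ (inZ wa)

  -- 0 = ¬0 forces h 0 = ¬(h 0).
  fixes-0 : h 0ℤ ≡ 0ℤ
  fixes-0 = self-neg⇒0 (preserves-neg (within-0 m))

  -- a ≤ b means a ∧ b = a, hence h a = h a ∧ h b ≤ h b.
  monotone : ∀ {a b} → Within m a → Within m b → a Z.≤ b → h a Z.≤ h b
  monotone {a} {b} wa wb a≤b = begin
    h a         ≡⟨ cong h (sym (ZP.i≤j⇒i⊓j≡i a≤b)) ⟩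
    h (a ⊓ b)   ≡⟨ preserves-⊓ wa wb ⟩
    h a ⊓ h b   ≤⟨ ZP.i⊓j≤j (h a) (h b) ⟩
    h b         ∎
    where open ZP.≤-Reasoning

  -- If a < b and h a = h b = c, then h(b → a) = h(¬(a → b)) gives c → c = ¬(c → c).
  private
    collapse< : ∀ {a b} → Within m a → Within m b → a Z.< b → h a ≡ h b → h a ≡ 0ℤ
    collapse< {a} {b} wa wb a<b ha≡hb = ⇒-self≡0 (h a) (self-neg⇒0 (begin
      h a ⇒ h a       ≡⟨ cong (_⇒ h a) ha≡hb ⟩
      h b ⇒ h a       ≡⟨ sym (preserves-⇒ wb wa) ⟩
      h (b ⇒ a)       ≡⟨ cong h (⇒-swap a<b) ⟩
      h (- (a ⇒ b))   ≡⟨ preserves-neg (within-⇒ wa wb) ⟩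
      - h (a ⇒ b)     ≡⟨ cong -_ (preserves-⇒ wa wb) ⟩
      - (h a ⇒ h b)   ≡⟨ cong (λ z → - (h a ⇒ z)) (sym ha≡hb) ⟩
      - (h a ⇒ h a)   ∎))
      where open ≡-Reasoning

  collapses-only-at-0 : ∀ {a b} → Within m a → Within m b → a ≢ b → h a ≡ h b → h a ≡ 0ℤ × h b ≡ 0ℤ
  collapses-only-at-0 {a} {b} wa wb a≢b ha≡hb with ZP.<-cmp a b
  ... | tri< a<b _ _ = collapse< wa wb a<b ha≡hb , trans (sym ha≡hb) (collapse< wa wb a<b ha≡hb)
  ... | tri≈ _ a≡b _ = ⊥-elim (a≢b a≡b)
  ... | tri> _ _ b<a = trans ha≡hb (collapse< wb wa b<a (sym ha≡hb)) , collapse< wb wa b<a (sym ha≡hb)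

  -- Z_k contains h 0 = 0, and the even algebras Z_{2n} omit 0.
  codomain-odd : ∃ λ n → k ≡ 2 * n + 1
  codomain-odd with maps-into (within-0 m)
  ... | inj₁ (n , k≡2n+1 , _) = n , k≡2n+1
  ... | inj₂ (_ , _ , _ , _ , _ , h0≢0) = ⊥-elim (h0≢0 fixes-0)

  image-0 : Image (2 * m + 1) h 0ℤ
  image-0 = 0ℤ , inZ (within-0 m) , fixes-0

  image-closed₂ : (_∙_ : ℤ → ℤ → ℤ) → (∀ {a b} → Within m a → Within m b → Within m (a ∙ b)) →
                  (∀ {a b} → Within m a → Within m b → h (a ∙ b) ≡ h a ∙ h b) →
                  ∀ {c d} → Image (2 * m + 1) h c → Image (2 * m + 1) h d → Image (2 * m + 1) h (c ∙ d)
  image-closed₂ _∙_ closed preserves (a , ia , refl) (b , ib , refl) =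
    a ∙ b , inZ (closed wa wb) , preserves wa wb
    where
    wa : Within m a
    wa = InZ-odd⇒within m ia
    wb : Within m b
    wb = InZ-odd⇒within m ib

  image-neg : ∀ {c} → Image (2 * m + 1) h c → Image (2 * m + 1) h (- c)
  image-neg (a , ia , refl) = - a , inZ (within-neg wa) , preserves-neg wa
    where
    wa : Within m a
    wa = InZ-odd⇒within m ia

  image-into : ∀ {c} → Image (2 * m + 1) h c → InZ k c
  image-into (a , ia , refl) = maps-into (InZ-odd⇒within m ia)

module OrderPreservingEndomorphism (m : ℕ) (h : ℤ → ℤ)
  (into : ∀ {a} → Within m a → Within m (h a))
  (monotone : ∀ {a b} → Within m a → Within m b → a Z.≤ b → h a Z.≤ h b)
  (odd : ∀ {a} → Within m a → h (- a) ≡ - h a)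
  (collapse : ∀ {a b} → Within m a → Within m b → a ≢ b → h a ≡ h b → h a ≡ 0ℤ) where

  -- On a chain, monotone maps preserve meets and joins.
  preserves-⊓ : ∀ {a b} → Within m a → Within m b → h (a ⊓ b) ≡ h a ⊓ h b
  preserves-⊓ {a} {b} wa wb with ≤-or-> a b
  ... | inj₁ a≤b = trans (cong h (ZP.i≤j⇒i⊓j≡i a≤b)) (sym (ZP.i≤j⇒i⊓j≡i (monotone wa wb a≤b)))
  ... | inj₂ b<a = trans (cong h (ZP.i≥j⇒i⊓j≡j (ZP.<⇒≤ b<a)))
                         (sym (ZP.i≥j⇒i⊓j≡j (monotone wb wa (ZP.<⇒≤ b<a))))

  preserves-⊔ : ∀ {a b} → Within m a → Within m b → h (a ⊔ b) ≡ h a ⊔ h b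
  preserves-⊔ {a} {b} wa wb with ≤-or-> a b
  ... | inj₁ a≤b = trans (cong h (ZP.i≤j⇒i⊔j≡j a≤b)) (sym (ZP.i≤j⇒i⊔j≡j (monotone wa wb a≤b)))
  ... | inj₂ b<a = trans (cong h (ZP.i≥j⇒i⊔j≡i (ZP.<⇒≤ b<a)))
                         (sym (ZP.i≥j⇒i⊔j≡i (monotone wb wa (ZP.<⇒≤ b<a))))

  -- Implication: the order between h a and h b matches that between a and b,
  -- except when b < a collapses to h a = h b, which by hypothesis is 0 ⇒ 0 = 0.
  preserves-⇒ : ∀ {a b} → Within m a → Within m b → h (a ⇒ b) ≡ h a ⇒ h b
  preserves-⇒ {a} {b} wa wb with ≤-or-> a b
  ... | inj₁ a≤b = begin
    h (a ⇒ b)       ≡⟨ cong h (⇒-of-≤ a≤b) ⟩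
    h (- a ⊔ b)     ≡⟨ preserves-⊔ (within-neg wa) wb ⟩
    h (- a) ⊔ h b   ≡⟨ cong (_⊔ h b) (odd wa) ⟩
    - h a ⊔ h b     ≡⟨ sym (⇒-of-≤ (monotone wa wb a≤b)) ⟩
    h a ⇒ h b       ∎
    where open ≡-Reasoning
  ... | inj₂ b<a = begin
    h (a ⇒ b)       ≡⟨ cong h (⇒-of-> b<a) ⟩
    h (- a ⊓ b)     ≡⟨ preserves-⊓ (within-neg wa) wb ⟩
    h (- a) ⊓ h b   ≡⟨ cong (_⊓ h b) (odd wa) ⟩
    - h a ⊓ h b     ≡⟨ ⇒-on-values (≤-or-> (h a) (h b)) ⟩
    h a ⇒ h b       ∎
    where
    open ≡-Reasoning
    ⇒-on-values : h a Z.≤ h b ⊎ h b Z.< h a → - h a ⊓ h b ≡ h a ⇒ h b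
    ⇒-on-values (inj₂ hb<ha) = sym (⇒-of-> hb<ha)
    ⇒-on-values (inj₁ ha≤hb) = trans (cong₂ (λ u v → - u ⊓ v) ha≡0 hb≡0) (sym (cong₂ _⇒_ ha≡0 hb≡0))
      where
      ha≡hb : h a ≡ h b
      ha≡hb = ZP.≤-antisym ha≤hb (monotone wb wa (ZP.<⇒≤ b<a))
      ha≡0 : h a ≡ 0ℤ
      ha≡0 = collapse wa wb (λ a≡b → ZP.<-irrefl (sym a≡b) b<a) ha≡hb
      hb≡0 : h b ≡ 0ℤ
      hb≡0 = trans (sym ha≡hb) ha≡0

  isEndomorphism : IsHom (2 * m + 1) (2 * m + 1) h
  isEndomorphism =
      (λ a ia → inZ (into (w ia)))
    , (λ a b ia ib → preserves-⊓ (w ia) (w ib))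
    , (λ a b ia ib → preserves-⊔ (w ia) (w ib))
    , (λ a b ia ib → preserves-⇒ (w ia) (w ib))
    , (λ a ia → odd (w ia))
    where
    w : ∀ {a} → InZ (2 * m + 1) a → Within m a
    w = InZ-odd⇒within m
    inZ : ∀ {a} → Within m a → InZ (2 * m + 1) a
    inZ = within⇒InZ-odd m

downward-induction : ∀ m (P : ℕ → Set) →
  (∀ n → n ≤ m → (∀ p → n < p → p ≤ m → P p) → P n) → ∀ n → n ≤ m → P n
downward-induction m P step n n≤m = go m n n≤m (NP.m≤n+m m n)
  where
  -- j bounds the distance from n up to m
  go : ∀ j n → n ≤ m → m ≤ n + j → P n
  go zero n n≤m m≤n+0 = step n n≤m λ p n<p p≤m →
    ⊥-elim (NP.<⇒≱ n<p (NP.≤-trans p≤m (subst (m ≤_) (NP.+-identityʳ n) m≤n+0)))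
  go (suc j) n n≤m m≤n+1+j = step n n≤m λ p n<p p≤m →
    go j p p≤m (NP.≤-trans m≤n+1+j (subst (_≤ p + j) (sym (NP.+-suc n j)) (NP.+-monoˡ-≤ j n<p)))

Covers : ℕ → (ℤ → ℤ) → (ℤ → ℤ) → Set
Covers m h₁ h₂ = ∀ {a} → Within m a → ∃ λ y → Within m y × h₁ y ≡ h₂ a

-- Write h₂ n = h₁ y; y ≤ n contradicts
-- monotonicity of h₁, while y > n gives h₂ y = h₂ n, so h₂ n = 0 ≤ h₁ n.
not-below : ∀ m {h₁ h₂} → IsHom (2 * m + 1) (2 * m + 1) h₁ → IsHom (2 * m + 1) (2 * m + 1) h₂ →
  Covers m h₁ h₂ → ∀ {n} → n ≤ m → (∀ {y} → Within m y → + n Z.< y → h₁ y ≡ h₂ y) →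
  ¬ (h₁ (+ n) Z.< h₂ (+ n))
not-below m {h₁} {h₂} hom₁ hom₂ covers {n} n≤m agree h₁n<h₂n =
  refute (covers wn) (≤-or-> (proj₁ (covers wn)) (+ n))
  where
  module F₁ = HomomorphismFacts m (2 * m + 1) h₁ hom₁
  module F₂ = HomomorphismFacts m (2 * m + 1) h₂ hom₂
  wn : Within m (+ n)
  wn = within-+ n≤m
  0≤h₁n : 0ℤ Z.≤ h₁ (+ n)
  0≤h₁n = subst (Z._≤ h₁ (+ n)) F₁.fixes-0 (F₁.monotone (within-0 m) wn (+≤+ z≤n))
  refute : ((y , _ , _) : ∃ λ y → Within m y × h₁ y ≡ h₂ (+ n)) → y Z.≤ + n ⊎ + n Z.< y → ⊥
  refute (y , wy , h₁y≡h₂n) (inj₁ y≤n) =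
    ZP.<-irrefl h₁y≡h₂n (ZP.≤-<-trans (F₁.monotone wy wn y≤n) h₁n<h₂n)
  refute (y , wy , h₁y≡h₂n) (inj₂ n<y) =
    ZP.<-irrefl refl (ZP.≤-<-trans 0≤h₁n (subst (h₁ (+ n) Z.<_) h₂n≡0 h₁n<h₂n))
    where
    h₂y≡h₂n : h₂ y ≡ h₂ (+ n)
    h₂y≡h₂n = trans (sym (agree wy n<y)) h₁y≡h₂n
    h₂n≡0 : h₂ (+ n) ≡ 0ℤ
    h₂n≡0 = proj₂ (F₂.collapses-only-at-0 wy wn (λ y≡n → ZP.<-irrefl (sym y≡n) n<y) h₂y≡h₂n)

-- Two endomorphisms covering each other agree: downward induction on [0, m]
-- with `not-below` in both directions, then oddness for negative arguments.
covering-endomorphisms-agree : ∀ m {h₁ h₂} →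
  IsHom (2 * m + 1) (2 * m + 1) h₁ → IsHom (2 * m + 1) (2 * m + 1) h₂ →
  Covers m h₁ h₂ → Covers m h₂ h₁ → ∀ {a} → Within m a → h₁ a ≡ h₂ a
covering-endomorphisms-agree m {h₁} {h₂} hom₁ hom₂ covers₁₂ covers₂₁ {a} wa = agree-on a wa
  where
  module F₁ = HomomorphismFacts m (2 * m + 1) h₁ hom₁
  module F₂ = HomomorphismFacts m (2 * m + 1) h₂ hom₂

  agree-above : ∀ {n} → (∀ p → n < p → p ≤ m → h₁ (+ p) ≡ h₂ (+ p)) →
                ∀ {y} → Within m y → + n Z.< y → h₁ y ≡ h₂ y
  agree-above ih (_ , +≤+ p≤m) (+<+ n<p) = ih _ n<p p≤m

  step : ∀ n → n ≤ m → (∀ p → n < p → p ≤ m → h₁ (+ p) ≡ h₂ (+ p)) → h₁ (+ n) ≡ h₂ (+ n)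
  step n n≤m ih with ZP.<-cmp (h₁ (+ n)) (h₂ (+ n))
  ... | tri< lt _ _ = ⊥-elim (not-below m hom₁ hom₂ covers₁₂ n≤m (agree-above ih) lt)
  ... | tri≈ _ eq _ = eq
  ... | tri> _ _ gt = ⊥-elim (not-below m hom₂ hom₁ covers₂₁ n≤m (λ wy n<y → sym (agree-above ih wy n<y)) gt)

  agree-on : ∀ a → Within m a → h₁ a ≡ h₂ a
  agree-on (+ n) wa = downward-induction m (λ n → h₁ (+ n) ≡ h₂ (+ n)) step n (within-+⁻¹ wa)
  agree-on -[1+ n ] wa = begin
    h₁ (- + suc n)     ≡⟨ F₁.preserves-neg w ⟩
    - h₁ (+ suc n)     ≡⟨ cong -_ (agree-on (+ suc n) w) ⟩
    - h₂ (+ suc n)     ≡⟨ sym (F₂.preserves-neg w) ⟩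
    h₂ (- + suc n)     ∎
    where
    open ≡-Reasoning
    w : Within m (+ suc n)
    w = within-neg wa

image? : ∀ m (h : ℤ → ℤ) c → Dec (Image (2 * m + 1) h c)
image? m h c = map′ found search (NP.anyUpTo? (λ n → h (+ n) Z.≟ c ⊎-dec h (- + n) Z.≟ c) (suc m))
  where
  found : (∃ λ n → n < suc m × (h (+ n) ≡ c ⊎ h (- + n) ≡ c)) → Image (2 * m + 1) h c
  found (n , s≤s n≤m , inj₁ e) = + n , within⇒InZ-odd m (within-+ n≤m) , e
  found (n , s≤s n≤m , inj₂ e) = - + n , within⇒InZ-odd m (within-neg (within-+ n≤m)) , e
  search : Image (2 * m + 1) h c → ∃ λ n → n < suc m × (h (+ n) ≡ c ⊎ h (- + n) ≡ c)
  search (+ n , ia , e) = n , s≤s (within-+⁻¹ (InZ-odd⇒within m ia)) , inj₁ e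
  search (-[1+ n ] , ia , e) = suc n , s≤s (within-+⁻¹ (within-neg (InZ-odd⇒within m ia))) , inj₂ e

imageSet : ℕ → (ℤ → ℤ) → ℤ → Bool
imageSet m h c = does (image? m h c)

does-true⇔ : ∀ {A : Set} (a? : Dec A) → does a? ≡ true ⇔ A
does-true⇔ (yes a) = mk⇔ (λ _ → a) (λ _ → refl)
does-true⇔ (no ¬a) = mk⇔ (λ ()) (λ a → ⊥-elim (¬a a))

imageSet-spec : ∀ m h c → imageSet m h c ≡ true ⇔ Image (2 * m + 1) h c
imageSet-spec m h c = does-true⇔ (image? m h c)

imageSubalgebra : ∀ m k h → IsHom (2 * m + 1) k h → Subalg0 k
imageSubalgebra m k h hom =
    imageSet m h
  , (subset , closed _⊓_ within-⊓ preserves-⊓ , closed _⊔_ within-⊔ preserves-⊔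
            , closed _⇒_ within-⇒ preserves-⇒ , closed-neg)
  , inImage image-0
  where
  open HomomorphismFacts m k h hom
  member : ∀ {c} → imageSet m h c ≡ true → Image (2 * m + 1) h c
  member {c} = Equivalence.to (imageSet-spec m h c)
  inImage : ∀ {c} → Image (2 * m + 1) h c → imageSet m h c ≡ true
  inImage {c} = Equivalence.from (imageSet-spec m h c)
  subset : ∀ a → imageSet m h a ≡ true → InZ k a
  subset a = image-into ∘ member
  closed : (_∙_ : ℤ → ℤ → ℤ) → (∀ {a b} → Within m a → Within m b → Within m (a ∙ b)) →
           (∀ {a b} → Within m a → Within m b → h (a ∙ b) ≡ h a ∙ h b) →
           ∀ a b → imageSet m h a ≡ true → imageSet m h b ≡ true → imageSet m h (a ∙ b) ≡ true
  closed _∙_ within preserves a b ea eb = inImage (image-closed₂ _∙_ within preserves (member ea) (member eb))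
  closed-neg : ∀ a → imageSet m h a ≡ true → imageSet m h (- a) ≡ true
  closed-neg a = inImage ∘ image-neg ∘ member

-- For a decidable set P ⊆ ℕ containing 0, `enum i` is the i-th largest
-- element of P ∩ [0, m], and 0 once those are exhausted.
module TopDownEnumeration (P : ℕ → Bool) (P0 : P 0 ≡ true) (m : ℕ) where

  largest≤ : ℕ → ℕ
  largest≤ zero = zero
  largest≤ (suc s) = if P (suc s) then suc s else largest≤ s

  largest≤-≤ : ∀ s → largest≤ s ≤ s
  largest≤-≤ zero = z≤n
  largest≤-≤ (suc s) with P (suc s)
  ... | true = NP.≤-refl
  ... | false = NP.m≤n⇒m≤1+n (largest≤-≤ s)

  largest≤-∈ : ∀ s → P (largest≤ s) ≡ true
  largest≤-∈ zero = P0
  largest≤-∈ (suc s) with P (suc s) in Ps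
  ... | true = Ps
  ... | false = largest≤-∈ s

  largest≤-max : ∀ {t} s → P t ≡ true → t ≤ s → t ≤ largest≤ s
  largest≤-max zero _ t≤0 = t≤0
  largest≤-max {t} (suc s) Pt t≤1+s with P (suc s) in Ps | NP.m≤n⇒m<n∨m≡n t≤1+s
  ... | true | _ = t≤1+s
  ... | false | inj₁ t<1+s = largest≤-max s Pt (s≤s⁻¹ t<1+s)
  ... | false | inj₂ refl with trans (sym Pt) Ps
  ...   | ()

  below : ℕ → ℕ
  below zero = zero
  below (suc s) = largest≤ s

  below-∈ : ∀ s → P (below s) ≡ true
  below-∈ zero = P0
  below-∈ (suc s) = largest≤-∈ s

  below-≤-pred : ∀ s → below s ≤ pred s
  below-≤-pred zero = z≤n
  below-≤-pred (suc s) = largest≤-≤ s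

  enum : ℕ → ℕ
  enum zero = largest≤ m
  enum (suc i) = below (enum i)

  enum-∈ : ∀ i → P (enum i) ≡ true
  enum-∈ zero = largest≤-∈ m
  enum-∈ (suc i) = below-∈ (enum i)

  -- each step goes strictly down, so after i steps we are at most m ∸ i
  enum-≤ : ∀ i → enum i ≤ m ∸ i
  enum-≤ zero = largest≤-≤ m
  enum-≤ (suc i) = begin
    below (enum i)   ≤⟨ below-≤-pred (enum i) ⟩
    pred (enum i)    ≤⟨ NP.pred-mono-≤ (enum-≤ i) ⟩
    pred (m ∸ i)     ≡⟨ NP.pred[m∸n]≡m∸[1+n] m i ⟩
    m ∸ suc i        ∎
    where open NP.≤-Reasoning

  enum-antitone : ∀ {i j} → i ≤ j → enum j ≤ enum i
  enum-antitone i≤j = go (NP.≤⇒≤′ i≤j)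
    where
    go : ∀ {i j} → i ≤′ j → enum j ≤ enum i
    go ≤′-refl = NP.≤-refl
    go (≤′-step {n} i≤′n) = NP.≤-trans (NP.≤-trans (below-≤-pred (enum n)) NP.pred[n]≤n) (go i≤′n)

  below-< : ∀ {s} → s ≢ 0 → below s < s
  below-< {zero} s≢0 = ⊥-elim (s≢0 refl)
  below-< {suc s} _ = s≤s (largest≤-≤ s)

  enum-collapse< : ∀ {i j} → i < j → enum i ≡ enum j → enum i ≡ 0
  enum-collapse< {i} {j} i<j eᵢ≡eⱼ with enum i NP.≟ 0
  ... | yes eᵢ≡0 = eᵢ≡0
  ... | no eᵢ≢0 = ⊥-elim (NP.<-irrefl (sym eᵢ≡eⱼ) (NP.≤-<-trans (enum-antitone i<j) (below-< eᵢ≢0)))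

  enum-collapse : ∀ {i j} → i ≢ j → enum i ≡ enum j → enum i ≡ 0
  enum-collapse {i} {j} i≢j eᵢ≡eⱼ with NP.<-cmp i j
  ... | tri< i<j _ _ = enum-collapse< i<j eᵢ≡eⱼ
  ... | tri≈ _ i≡j _ = ⊥-elim (i≢j i≡j)
  ... | tri> _ _ j<i = trans eᵢ≡eⱼ (enum-collapse< j<i (sym eᵢ≡eⱼ))

  enumerated-or-below : ∀ {t} → P t ≡ true → t ≤ m → ∀ i → (∃ λ j → j ≤ i × enum j ≡ t) ⊎ t < enum i
  enumerated-or-below {t} Pt t≤m zero with NP.m≤n⇒m<n∨m≡n (largest≤-max m Pt t≤m)
  ... | inj₁ t<e₀ = inj₂ t<e₀
  ... | inj₂ t≡e₀ = inj₁ (0 , z≤n , sym t≡e₀)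
  enumerated-or-below {t} Pt t≤m (suc i) with enumerated-or-below Pt t≤m i
  ... | inj₁ (j , j≤i , eⱼ≡t) = inj₁ (j , NP.m≤n⇒m≤1+n j≤i , eⱼ≡t)
  ... | inj₂ t<eᵢ with NP.m≤n⇒m<n∨m≡n (below-above t<eᵢ)
    where
    below-above : ∀ {s} → t < s → t ≤ below s
    below-above {suc s} t<1+s = largest≤-max s Pt (s≤s⁻¹ t<1+s)
  ...   | inj₁ t<eᵢ₊₁ = inj₂ t<eᵢ₊₁
  ...   | inj₂ t≡eᵢ₊₁ = inj₁ (suc i , NP.≤-refl , sym t≡eᵢ₊₁)

  -- After m steps the enumeration has reached 0, so it has listed all of P ∩ [0, m].
  enum-onto : ∀ {t} → P t ≡ true → t ≤ m → ∃ λ i → i ≤ m × enum i ≡ t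
  enum-onto {t} Pt t≤m with enumerated-or-below Pt t≤m m
  ... | inj₁ found = found
  ... | inj₂ t<eₘ = ⊥-elim (NP.n≮0 (subst (t <_) (NP.n∸n≡0 m) (NP.<-≤-trans t<eₘ (enum-≤ m))))

oddExtension : (ℕ → ℕ) → ℤ → ℤ
oddExtension f (+ n) = + f n
oddExtension f -[1+ n ] = - + f (suc n)

module _ (f : ℕ → ℕ) where

  oddExtension-odd : f 0 ≡ 0 → ∀ a → oddExtension f (- a) ≡ - oddExtension f a
  oddExtension-odd f0≡0 (+ zero) rewrite f0≡0 = refl
  oddExtension-odd f0≡0 (+ suc n) = refl
  oddExtension-odd f0≡0 -[1+ n ] = sym (ZP.neg-involutive (+ f (suc n)))

  oddExtension-monotone : (∀ {p q} → p ≤ q → f p ≤ f q) →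
    ∀ {a b} → a Z.≤ b → oddExtension f a Z.≤ oddExtension f b
  oddExtension-monotone mono (+≤+ p≤q) = +≤+ (mono p≤q)
  oddExtension-monotone mono -≤+ = ZP.neg-≤-pos
  oddExtension-monotone mono (-≤- q≤p) = ZP.neg-mono-≤ (+≤+ (mono (s≤s q≤p)))

  oddExtension-within : ∀ {m} → (∀ n → f n ≤ m) → ∀ a → Within m (oddExtension f a)
  oddExtension-within f≤m (+ n) = within-+ (f≤m n)
  oddExtension-within f≤m -[1+ n ] = within-neg (within-+ (f≤m (suc n)))

  oddExtension-collapse : ∀ {m} → (∀ {p q} → p ≤ m → q ≤ m → p ≢ q → f p ≡ f q → f p ≡ 0) →
    ∀ {a b} → Within m a → Within m b → a ≢ b → oddExtension f a ≡ oddExtension f b →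
    oddExtension f a ≡ 0ℤ
  oddExtension-collapse collapse {+ p} {+ q} wa wb a≢b e =
    cong +_ (collapse (within-+⁻¹ wa) (within-+⁻¹ wb) (λ p≡q → a≢b (cong +_ p≡q)) (ZP.+-injective e))
  oddExtension-collapse collapse { -[1+ p ]} { -[1+ q ]} wa wb a≢b e =
    cong (λ x → - + x) (collapse (within-+⁻¹ (within-neg wa)) (within-+⁻¹ (within-neg wb))
      (λ p≡q → a≢b (cong -[1+_] (NP.suc-injective p≡q))) (ZP.+-injective (ZP.neg-injective e)))
  oddExtension-collapse collapse {+ p} { -[1+ q ]} wa wb a≢b e =
    cong +_ (proj₁ (opposite-signs _ _ e))
  oddExtension-collapse collapse { -[1+ p ]} {+ q} wa wb a≢b e =
    cong (λ x → - + x) (proj₂ (opposite-signs _ _ (sym e)))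

module SubalgebraEndomorphism (m : ℕ) (T : Subalg0 (2 * m + 1)) where

  private
    S : ℤ → Bool
    S = proj₁ T
    S-within : ∀ {a} → S a ≡ true → Within m a
    S-within {a} Sa = InZ-odd⇒within m (proj₁ (proj₁ (proj₂ T)) a Sa)
    S-neg : ∀ {a} → S a ≡ true → S (- a) ≡ true
    S-neg {a} = proj₂ (proj₂ (proj₂ (proj₂ (proj₁ (proj₂ T))))) a

  open TopDownEnumeration (λ n → S (+ n)) (proj₂ (proj₂ T)) m

  -- On [0, m] the endomorphism sends m, m-1, ... to the elements of S ∩ [0, m]
  -- in decreasing order.
  profile : ℕ → ℕ
  profile n = enum (m ∸ n)

  profile-0 : profile 0 ≡ 0
  profile-0 = NP.n≤0⇒n≡0 (subst (enum m ≤_) (NP.n∸n≡0 m) (enum-≤ m))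

  profile-≤ : ∀ n → profile n ≤ m
  profile-≤ n = NP.≤-trans (enum-≤ (m ∸ n)) (NP.m∸n≤m m (m ∸ n))

  profile-monotone : ∀ {p q} → p ≤ q → profile p ≤ profile q
  profile-monotone p≤q = enum-antitone (NP.∸-monoʳ-≤ m p≤q)

  profile-collapse : ∀ {p q} → p ≤ m → q ≤ m → p ≢ q → profile p ≡ profile q → profile p ≡ 0
  profile-collapse p≤m q≤m p≢q = enum-collapse (λ e → p≢q (NP.∸-cancelˡ-≡ p≤m q≤m e))

  endo : ℤ → ℤ
  endo = oddExtension profile

  isEndomorphism : IsHom (2 * m + 1) (2 * m + 1) endo
  isEndomorphism = OrderPreservingEndomorphism.isEndomorphism m endo
    (λ {a} _ → oddExtension-within profile profile-≤ a)
    (λ _ _ → oddExtension-monotone profile profile-monotone)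
    (λ {a} _ → oddExtension-odd profile profile-0 a)
    (oddExtension-collapse profile profile-collapse)

  preimage-+ : ∀ {t} → S (+ t) ≡ true → ∃ λ a → Within m a × endo a ≡ + t
  preimage-+ {t} St with enum-onto St (within-+⁻¹ (S-within St))
  ... | i , i≤m , eᵢ≡t =
    + (m ∸ i) , within-+ (NP.m∸n≤m m i) , cong +_ (trans (cong enum (NP.m∸[m∸n]≡n i≤m)) eᵢ≡t)

  image⊆S : ∀ {c} → Image (2 * m + 1) endo c → S c ≡ true
  image⊆S (+ n , _ , refl) = enum-∈ (m ∸ n)
  image⊆S (-[1+ n ] , _ , refl) = S-neg (enum-∈ (m ∸ suc n))

  S⊆image : ∀ {c} → S c ≡ true → Image (2 * m + 1) endo c
  S⊆image {+ t} St with preimage-+ St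
  ... | a , wa , endo-a≡t = a , within⇒InZ-odd m wa , endo-a≡t
  S⊆image { -[1+ t ]} S-t with preimage-+ (S-neg S-t)
  ... | a , wa , endo-a≡t = - a , within⇒InZ-odd m (within-neg wa) ,
          trans (oddExtension-odd profile profile-0 a) (cong -_ endo-a≡t)

  image-spec : ∀ c → Image (2 * m + 1) endo c ⇔ S c ≡ true
  image-spec c = mk⇔ image⊆S S⊆image

sameImage⇒⇔ : ∀ {k h₁ h₂} → SameImage k h₁ h₂ → ∀ c → Image k h₁ c ⇔ Image k h₂ c
sameImage⇒⇔ same c = mk⇔ (proj₁ (same c)) (proj₂ (same c))

⇔⇒sameImage : ∀ {k h₁ h₂} → (∀ c → Image k h₁ c ⇔ Image k h₂ c) → SameImage k h₁ h₂
⇔⇒sameImage same c = Equivalence.to (same c) , Equivalence.from (same c)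

≡⇒true⇔true : ∀ {b₁ b₂ : Bool} → b₁ ≡ b₂ → (b₁ ≡ true ⇔ b₂ ≡ true)
≡⇒true⇔true b₁≡b₂ = mk⇔ (trans (sym b₁≡b₂)) (trans b₁≡b₂)

module Endomorphisms (m : ℕ) where

  equal⇒sameImage : ∀ (h₁ h₂ : End (2 * m + 1)) → HomEq (2 * m + 1) (2 * m + 1) h₁ h₂ →
                    ∀ c → Image (2 * m + 1) (proj₁ h₁) c ⇔ Image (2 * m + 1) (proj₁ h₂) c
  equal⇒sameImage (h₁ , _) (h₂ , _) h₁≈h₂ c = mk⇔
    (λ (a , ia , e) → a , ia , trans (sym (h₁≈h₂ a ia)) e)
    (λ (a , ia , e) → a , ia , trans (h₁≈h₂ a ia) e)

  sameImage⇒equal : ∀ (h₁ h₂ : End (2 * m + 1)) →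
                    (∀ c → Image (2 * m + 1) (proj₁ h₁) c ⇔ Image (2 * m + 1) (proj₁ h₂) c) →
                    HomEq (2 * m + 1) (2 * m + 1) h₁ h₂
  sameImage⇒equal (h₁ , hom₁) (h₂ , hom₂) same a ia =
    covering-endomorphisms-agree m hom₁ hom₂ (covers (⇔.sym ∘ same)) (covers same) (InZ-odd⇒within m ia)
    where
    covers : ∀ {g₁ g₂} → (∀ c → Image (2 * m + 1) g₁ c ⇔ Image (2 * m + 1) g₂ c) → Covers m g₂ g₁
    covers g₁≅g₂ wa with Equivalence.to (g₁≅g₂ _) (_ , within⇒InZ-odd m wa , refl)
    ... | y , iy , e = y , InZ-odd⇒within m iy , e

  toSubalgebra : End (2 * m + 1) → Subalg0 (2 * m + 1)
  toSubalgebra (h , hom) = imageSubalgebra m (2 * m + 1) h hom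

  toSubalgebra-spec : ∀ h c → proj₁ (toSubalgebra h) c ≡ true ⇔ Image (2 * m + 1) (proj₁ h) c
  toSubalgebra-spec (h , _) = imageSet-spec m h

  fromSubalgebra : Subalg0 (2 * m + 1) → End (2 * m + 1)
  fromSubalgebra T = endo , isEndomorphism
    where open SubalgebraEndomorphism m T

  fromSubalgebra-spec : ∀ T c → Image (2 * m + 1) (proj₁ (fromSubalgebra T)) c ⇔ proj₁ T c ≡ true
  fromSubalgebra-spec T = image-spec
    where open SubalgebraEndomorphism m T

  -- h ↦ h[Z_{2m+1}] is a bijection; all four laws reduce to comparing images.
  endomorphisms≅subalgebras : Inverse (EndSetoid (2 * m + 1)) (Subalg0Setoid (2 * m + 1))
  endomorphisms≅subalgebras = record
    { to = toSubalgebra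
    ; from = fromSubalgebra
    ; to-cong = λ {h₁} {h₂} h₁≈h₂ c →
        does-⇔ (equal⇒sameImage h₁ h₂ h₁≈h₂ c) (image? m (proj₁ h₁) c) (image? m (proj₁ h₂) c)
    ; from-cong = λ {T₁} {T₂} T₁≈T₂ → sameImage⇒equal (fromSubalgebra T₁) (fromSubalgebra T₂) λ c →
        fromSubalgebra-spec T₁ c ⟨ ⇔.trans ⟩ ≡⇒true⇔true (T₁≈T₂ c) ⟨ ⇔.trans ⟩ ⇔.sym (fromSubalgebra-spec T₂ c)
    ; inverse = (λ {T} {h} h≈T c → ⇔→≡
          (toSubalgebra-spec h c ⟨ ⇔.trans ⟩ equal⇒sameImage h (fromSubalgebra T) h≈T c
                                 ⟨ ⇔.trans ⟩ fromSubalgebra-spec T c))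
      , (λ {h} {T} T≈h → sameImage⇒equal (fromSubalgebra T) h λ c →
          fromSubalgebra-spec T c ⟨ ⇔.trans ⟩ ≡⇒true⇔true (T≈h c) ⟨ ⇔.trans ⟩ toSubalgebra-spec h c)
    }

proposition2p3 : (m : ℕ) → 1 ≤ m →
    ((k : ℕ) → 1 ≤ k → (h : Hom (2 * m + 1) k) →
      (Σ ℕ λ n → k ≡ 2 * n + 1)
      × (∀ a b → InZ (2 * m + 1) a → InZ (2 * m + 1) b → a ≢ b →
           proj₁ h a ≡ proj₁ h b → (proj₁ h a ≡ 0ℤ) × (proj₁ h b ≡ 0ℤ)))
    × ((h₁ h₂ : End (2 * m + 1)) →
      (HomEq (2 * m + 1) (2 * m + 1) h₁ h₂ → SameImage (2 * m + 1) (proj₁ h₁) (proj₁ h₂))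
      × (SameImage (2 * m + 1) (proj₁ h₁) (proj₁ h₂) → HomEq (2 * m + 1) (2 * m + 1) h₁ h₂))
    × Inverse (EndSetoid (2 * m + 1)) (Subalg0Setoid (2 * m + 1))
proposition2p3 m _ =
    (λ k _ (h , hom) → let open HomomorphismFacts m k h hom in
        codomain-odd
      , λ a b ia ib → collapses-only-at-0 (InZ-odd⇒within m ia) (InZ-odd⇒within m ib))
  , (λ h₁ h₂ → ⇔⇒sameImage ∘ equal⇒sameImage h₁ h₂ , sameImage⇒equal h₁ h₂ ∘ sameImage⇒⇔)
  , endomorphisms≅subalgebras
  where open Endomorphisms m
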